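{- If $H$ is a graph on $m$ vertices with degeneracy at least $3$, then $g(H,k)=\Theta_m(k)$, i.e. there are constants $0<c_m\le C_m$ depending only on $m$ such that $c_m k\le g(H,k)\le C_m k$ for all sufficiently large $k$.
   Context: For a graph $H$, an edge colouring $c:E(K_n)\to[k]$ contains a rainbow copy of $H$ if some subgraph of $K_n$ isomorphic to $H$ has all its edges of pairwise distinct colours; otherwise it is rainbow $H$-free. The colouring has colour distribution sequence $(e_1,\dots,e_k)$ if exactly $e_i$ edges have colour $i$. $g(H,k)$ is the smallest integer $N$ such that for all $n\ge N$ and all non-negative integers $e_1,\dots,e_k$ with $\sum_i e_i=\binom n2$, there exists a rainbow $H$-free colouring of $K_n$ with colour distribution sequence $(e_1,\dots,e_k)$; if no such $N$ exists, $g(H,k)=\infty$. A graph is $d$-degenerate if every subgraph has a vertex of degree at most $d$; the degeneracy is the smallest positive $d$ for which it is $d$-degenerate. -}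

module Defs where

open import Data.Nat using (ℕ; _≤_; _<_; _*_)
open import Data.Nat.Combinatorics using (_C_)
open import Data.Bool using (Bool; true; false)
open import Data.Fin using (Fin; toℕ)
open import Data.Fin.Subset using (Subset; _∈_; Nonempty; ∣_∣)
open import Data.Vec using (tabulate)
open import Data.List using (List; length; filter; allFin; map; concatMap)
open import Data.Nat.ListAction using (sum)
open import Data.Product using (Σ; _×_; _,_; ∃; ∃-syntax)
open import Data.Sum using (_⊎_)
open import Relation.Nullary using (¬_)
open import Relation.Binary.PropositionalEquality using (_≡_; _≢_)
open import Data.Nat.Properties using (_<?_)
open import Data.Fin.Properties using (_≟_)
open import Relation.Nullary.Decidable using (_×-dec_)
open import Function.Definitions using (Injective)

record Graph (m : ℕ) : Set where
  field
    adj   : Fin m → Fin m → Bool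
    sym   : ∀ u v → adj u v ≡ adj v u
    irrefl : ∀ u → adj u u ≡ false
open Graph public

IsSubgraph : ∀ {m} → Graph m → Subset m → (Fin m → Fin m → Bool) → Set
IsSubgraph H S F =
  (∀ u v → F u v ≡ F v u) ×
  (∀ u v → F u v ≡ true → (adj H u v ≡ true) × (u ∈ S) × (v ∈ S))

degreeIn : ∀ {m} → (Fin m → Fin m → Bool) → Fin m → ℕ
degreeIn F v = ∣ tabulate (F v) ∣

Degenerate : ℕ → ∀ {m} → Graph m → Set
Degenerate d {m} H =
  (S : Subset m) (F : Fin m → Fin m → Bool) → IsSubgraph H S F → Nonempty S →
  ∃[ v ] (v ∈ S × degreeIn F v ≤ d)

-- degeneracy ≥ 3 : smallest positive d with H d-degenerate is ≥ 3,
-- i.e. H is neither 1- nor 2-degenerate.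
DegeneracyAtLeast3 : ∀ {m} → Graph m → Set
DegeneracyAtLeast3 H = ¬ Degenerate 1 H × ¬ Degenerate 2 H

-- An edge colouring of K_n with k colours (symmetric; diagonal irrelevant).
record Colouring (n k : ℕ) : Set where
  field
    col : Fin n → Fin n → Fin k
    col-sym : ∀ u v → col u v ≡ col v u
open Colouring public

allPairs : ∀ n → List (Fin n × Fin n)
allPairs n = concatMap (λ u → map (λ v → (u , v)) (allFin n)) (allFin n)

colourCount : ∀ {n k} → Colouring n k → Fin k → ℕ
colourCount {n} c i =
  length (filter (λ p → (toℕ (Data.Product.proj₁ p) <? toℕ (Data.Product.proj₂ p))
                         ×-dec (col c (Data.Product.proj₁ p) (Data.Product.proj₂ p) ≟ i))
                 (allPairs n))

HasDistribution : ∀ {n k} → Colouring n k → (Fin k → ℕ) → Set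
HasDistribution c e = ∀ i → colourCount c i ≡ e i

ContainsRainbow : ∀ {m n k} → Graph m → Colouring n k → Set
ContainsRainbow {m} {n} H c =
  Σ (Fin m → Fin n) λ φ → Injective _≡_ _≡_ φ ×
    (∀ a b a' b' → adj H a b ≡ true → adj H a' b' ≡ true →
       col c (φ a) (φ b) ≡ col c (φ a') (φ b') →
       (a ≡ a' × b ≡ b') ⊎ (a ≡ b' × b ≡ a'))

RainbowFree : ∀ {m n k} → Graph m → Colouring n k → Set
RainbowFree H c = ¬ ContainsRainbow H c

Threshold : ∀ {m} → Graph m → ℕ → ℕ → Set
Threshold H k N =
  ∀ n → N ≤ n → (e : Fin k → ℕ) → sum (map e (allFin k)) ≡ n C 2 →
  Σ (Colouring n k) λ c → HasDistribution c e × RainbowFree H c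

-- g(H,k) ≤ M   (g is the least threshold; ∞ if none)
gAtMost : ∀ {m} → Graph m → ℕ → ℕ → Set
gAtMost H k M = Threshold H k M

-- g(H,k) ≥ M : no N < M is a threshold (true when g = ∞)
gAtLeast : ∀ {m} → Graph m → ℕ → ℕ → Set
gAtLeast H k M = ∀ N → N < M → ¬ Threshold H k N

-- g(H,k) ≥ k / c′ (real division): no N with c′ * N < k is a threshold
gAtLeastFrac : ∀ {m} → Graph m → ℕ → ℕ → Set
gAtLeastFrac H k c′ = ∀ N → c′ * N < k → ¬ Threshold H k N

-- Upper bound. Colour K_n vertex by vertex so that the edges from each vertex to later vertices
-- use at most two colours. In a rainbow copy of H the first vertex of any subgraph then has degree
-- at most 2, so H would be 2-degenerate. Any distribution over k colours can be realised this way
-- once n ≥ 2k: the forward edges of the next vertex use up a colour with few edges left, topped up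
-- by a large colour, which keeps twice the number of unfinished colours at most the number of
-- remaining vertices.
--
-- Lower bound. On n = N + O_m(1) vertices take the balanced distribution. If k is a large multiple
-- of N every colour class has O(n²/k) edges, so each vertex sees each colour only o(n) times, and a
-- greedy choice of vertices builds a rainbow K_m, hence a rainbow copy of every H on m vertices.

module Submission where

open import Defs hiding (sym)
open import Algebra.Properties.CommutativeMonoid.Sum as Sum using ()
open import Data.Bool using (Bool; true; false; _∧_; _∨_; not; if_then_else_)
import Data.Bool.Properties as Bool
open import Data.Empty using (⊥-elim)
open import Data.Fin using (Fin; zero; suc; toℕ)
open import Data.Fin.Properties using (_≟_; any?; toℕ-injective)
import Data.Fin.Properties as Fin
open import Data.Fin.Subset using (∣_∣)
open import Data.Fin.Subset.Properties using (_∈?_)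
open import Data.List using (List; _++_; length; filter; map; concatMap; tabulate; allFin)
open import Data.List.Properties using (length-++; filter-++; map-tabulate)
open import Data.Nat using (ℕ; _≤_; _*_)
open import Data.Nat using (NonZero; zero; suc; pred; _+_; _∸_; _<_; z≤n; s≤s; _<ᵇ_; >-nonZero)
open import Data.Nat.Combinatorics using (_C_; nCk+nC[k+1]≡[n+1]C[k+1]; nC1≡n)
open import Data.Nat.DivMod using (_/_; _%_; m≡m%n+[m/n]*n; m%n<n; m/n*n≤m)
open import Data.Nat.ListAction using () renaming (sum to sumˡ)
open import Data.Nat.Properties hiding (_≟_)
open import Data.Nat.Tactic.RingSolver using (solve-∀)
open import Data.Product using (Σ; _×_)
open import Data.Product using (_,_; proj₁; proj₂; ∃; ∃₂)
open import Data.Sum using (_⊎_; inj₁; inj₂)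
open import Data.Unit using (⊤)
import Data.Vec as Vec
open import Data.Vec.Functional using (_∷_; head; tail)
open import Function using (_∘_; id)
open import Relation.Binary using (tri<; tri≈; tri>)
open import Relation.Binary.PropositionalEquality
open import Relation.Nullary using (Dec; yes; no; does; ¬_; _⊎-dec_)
open import Relation.Nullary.Decidable using (dec-true; _×-dec_)
open import Relation.Unary using (Pred; Decidable)

-- Finite sums and counting

open Sum +-0-commutativeMonoid using (sum; sum-syntax; sum-cong-≗; ∑-distrib-+; ∑-comm)

does-true : ∀ {a} {A : Set a} (d : Dec A) → does d ≡ true → A
does-true (yes a) _ = a

does-false : ∀ {a} {A : Set a} (d : Dec A) → does d ≡ false → ¬ A
does-false (no ¬a) _ = ¬a

not-true : ∀ {b} → not b ≡ true → b ≡ false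
not-true {false} _ = refl

∧-true : ∀ {a b} → a ∧ b ≡ true → a ≡ true × b ≡ true
∧-true {true} {true} _ = refl , refl

𝟙 : Bool → ℕ
𝟙 true  = 1
𝟙 false = 0

𝟙≤1 : ∀ b → 𝟙 b ≤ 1
𝟙≤1 true  = ≤-refl
𝟙≤1 false = z≤n

𝟙-mono : ∀ {a b} → (a ≡ true → b ≡ true) → 𝟙 a ≤ 𝟙 b
𝟙-mono {false} a⇒b = z≤n
𝟙-mono {true}  a⇒b rewrite a⇒b refl = ≤-refl

𝟙-≤ : ∀ {b r} → (b ≡ true → 1 ≤ r) → 𝟙 b ≤ r
𝟙-≤ {false} _     = z≤n
𝟙-≤ {true}  1≤r = 1≤r refl

𝟙-∨ : ∀ a b → 𝟙 (a ∨ b) ≤ 𝟙 a + 𝟙 b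
𝟙-∨ true  b = s≤s z≤n
𝟙-∨ false b = ≤-refl

𝟙-any? : ∀ {j p} {P : Fin j → Set p} (P? : Decidable P) → 𝟙 (does (any? P?)) ≤ ∑[ i < j ] 𝟙 (does (P? i))
𝟙-any? {zero}  P? = z≤n
𝟙-any? {suc j} P? with P? zero
... | yes _ = s≤s z≤n
... | no  _ = 𝟙-any? (P? ∘ suc)

sum-mono-≤ : ∀ {n} {f g : Fin n → ℕ} → (∀ i → f i ≤ g i) → sum f ≤ sum g
sum-mono-≤ {zero}  f≤g = z≤n
sum-mono-≤ {suc n} f≤g = +-mono-≤ (f≤g zero) (sum-mono-≤ (f≤g ∘ suc))

sum-const : ∀ n c → ∑[ i < n ] c ≡ n * c
sum-const zero    c = refl
sum-const (suc n) c = cong (c +_) (sum-const n c)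

sum-*ˡ : ∀ {n} c (f : Fin n → ℕ) → ∑[ i < n ] (c * f i) ≡ c * sum f
sum-*ˡ {zero}  c f = sym (*-zeroʳ c)
sum-*ˡ {suc n} c f = trans (cong (c * f zero +_) (sum-*ˡ c (f ∘ suc))) (sym (*-distribˡ-+ c (f zero) _))

≤-sum : ∀ {n} (f : Fin n → ℕ) i → f i ≤ sum f
≤-sum f zero    = m≤m+n _ _
≤-sum f (suc i) = ≤-trans (≤-sum (f ∘ suc) i) (m≤n+m _ _)

sum-≤-* : ∀ {n} (f : Fin n → ℕ) x → (∀ i → f i ≤ x) → sum f ≤ n * x
sum-≤-* {n} f x f≤x = ≤-trans (sum-mono-≤ f≤x) (≤-reflexive (sum-const n x))

count : ∀ {n} → (Fin n → Bool) → ℕ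
count P = sum (𝟙 ∘ P)

count-*ʳ : ∀ {n} (P : Fin n → Bool) x → ∑[ i < n ] (𝟙 (P i) * x) ≡ count P * x
count-*ʳ P x = begin
  sum (λ i → 𝟙 (P i) * x) ≡⟨ sum-cong-≗ (λ i → *-comm (𝟙 (P i)) x) ⟩
  sum (λ i → x * 𝟙 (P i)) ≡⟨ sum-*ˡ x (𝟙 ∘ P) ⟩
  x * count P             ≡⟨ *-comm x _ ⟩
  count P * x             ∎
  where open ≡-Reasoning

count≤n : ∀ {n} (P : Fin n → Bool) → count P ≤ n
count≤n {n} P = ≤-trans (sum-≤-* (𝟙 ∘ P) 1 (𝟙≤1 ∘ P)) (≤-reflexive (*-identityʳ n))

count-true : ∀ n → count {n} (λ _ → true) ≡ n
count-true n = trans (sum-const n 1) (*-identityʳ n)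

count-mono : ∀ {n} {P Q : Fin n → Bool} → (∀ i → P i ≡ true → Q i ≡ true) → count P ≤ count Q
count-mono P⇒Q = sum-mono-≤ (λ i → 𝟙-mono (P⇒Q i))

count-∨ : ∀ {n} (P Q : Fin n → Bool) → count (λ i → P i ∨ Q i) ≤ count P + count Q
count-∨ P Q = ≤-trans (sum-mono-≤ (λ i → 𝟙-∨ (P i) (Q i))) (≤-reflexive (∑-distrib-+ (𝟙 ∘ P) (𝟙 ∘ Q)))

count-any? : ∀ {j n p} {P : Fin j → Fin n → Set p} (P? : ∀ i w → Dec (P i w)) →
  count (λ w → does (any? (λ i → P? i w))) ≤ ∑[ i < j ] count (λ w → does (P? i w))
count-any? P? = ≤-trans (sum-mono-≤ (λ w → 𝟙-any? (λ i → P? i w))) (≤-reflexive (∑-comm (λ w i → 𝟙 (does (P? i w)))))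

count-any²? : ∀ {j n p} {P : Fin j → Fin j → Fin n → Set p} (P? : ∀ a b w → Dec (P a b w)) x →
  (∀ a b → count (λ w → does (P? a b w)) ≤ x) → count (λ w → does (any? λ a → any? λ b → P? a b w)) ≤ j * (j * x)
count-any²? {j} P? x bounded =
  ≤-trans (count-any? (λ a w → any? λ b → P? a b w)) (sum-≤-* _ (j * x) (λ a →
  ≤-trans (count-any? (P? a)) (sum-≤-* _ x (bounded a))))

count-≡0 : ∀ {n} (P : Fin n → Bool) → (∀ i → P i ≡ false) → count P ≡ 0
count-≡0 {zero}  P P≡false = refl
count-≡0 {suc n} P P≡false rewrite P≡false zero = count-≡0 (P ∘ suc) (P≡false ∘ suc)

count-≤1 : ∀ {n} (P : Fin n → Bool) → (∀ i i′ → P i ≡ true → P i′ ≡ true → i ≡ i′) → count P ≤ 1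
count-≤1 {zero}  P unique = z≤n
count-≤1 {suc n} P unique with P zero in P0
... | true  = ≤-reflexive (cong suc (count-≡0 (P ∘ suc) others))
  where
  others : ∀ i → P (suc i) ≡ false
  others i with P (suc i) in Pi
  ... | true  with () ← unique zero (suc i) P0 Pi
  ... | false = refl
... | false = count-≤1 (P ∘ suc) (λ i i′ Pi Pi′ → Fin.suc-injective (unique (suc i) (suc i′) Pi Pi′))

count-≡-≤1 : ∀ {n} (x : Fin n) → count (λ w → does (w ≟ x)) ≤ 1
count-≡-≤1 x = count-≤1 _ (λ i i′ i≡x i′≡x → trans (does-true (i ≟ x) i≡x) (sym (does-true (i′ ≟ x) i′≡x)))

count-≟ : ∀ {K} (α : Fin K) → count (λ i → does (α ≟ i)) ≡ 1
count-≟ {suc K} zero = cong suc (count-≡0 {K} _ (λ _ → refl))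
count-≟ {suc K} (suc α) = count-≟ α

1≤count⇒∃ : ∀ {n} (P : Fin n → Bool) → 1 ≤ count P → ∃ λ i → P i ≡ true
1≤count⇒∃ {suc n} P 1≤count with P zero in P0
... | true  = zero , P0
... | false with i , Pi ← 1≤count⇒∃ (P ∘ suc) 1≤count = suc i , Pi

count-< : ∀ {n} {P Q : Fin n → Bool} → (∀ i → P i ≡ true → Q i ≡ true) →
  ∀ a → P a ≡ false → Q a ≡ true → count P < count Q
count-< {P = P} P⇒Q zero    Pa Qa rewrite Pa | Qa = s≤s (count-mono (P⇒Q ∘ suc))
count-< {P = P} P⇒Q (suc a) Pa Qa =
  ≤-trans (≤-reflexive (sym (+-suc (𝟙 (P zero)) _))) (+-mono-≤ (𝟙-mono (P⇒Q zero)) (count-< (P⇒Q ∘ suc) a Pa Qa))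

count*min≤sum : ∀ {n} (W : Fin n → Bool) (g : Fin n → ℕ) v → (∀ w → W w ≡ true → g v ≤ g w) → count W * g v ≤ sum g
count*min≤sum W g v v-min = ≤-trans (≤-reflexive (sym (count-*ʳ W (g v)))) (sum-mono-≤ pointwise)
  where
  pointwise : ∀ w → 𝟙 (W w) * g v ≤ g w
  pointwise w with W w in Ww
  ... | true  = ≤-trans (≤-reflexive (+-identityʳ (g v))) (v-min w Ww)
  ... | false = z≤n

argmin : ∀ {m p} {P : Fin m → Set p} → Decidable P → (g : Fin m → ℕ) → ∃ P →
  ∃ λ v → P v × (∀ w → P w → g v ≤ g w)
argmin {suc m} {P = P} P? g (x , Px) with any? (P? ∘ suc)
... | no ¬P∘suc = zero , P0 x Px , λ { zero _ → ≤-refl ; (suc w) Pw → ⊥-elim (¬P∘suc (w , Pw)) }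
  where
  P0 : ∀ x → P x → P zero
  P0 zero    Px = Px
  P0 (suc w) Pw = ⊥-elim (¬P∘suc (w , Pw))
... | yes ∃P∘suc with v , Pv , v-min ← argmin (P? ∘ suc) (g ∘ suc) ∃P∘suc with P? zero
...   | no ¬P0 = suc v , Pv , λ { zero P0 → ⊥-elim (¬P0 P0) ; (suc w) Pw → v-min w Pw }
...   | yes P0 with g zero ≤? g (suc v)
...     | yes g0≤ = zero , P0 , λ { zero _ → ≤-refl ; (suc w) Pw → ≤-trans g0≤ (v-min w Pw) }
...     | no g0≰ = suc v , Pv , λ { zero _ → <⇒≤ (≰⇒> g0≰) ; (suc w) Pw → v-min w Pw }

-- Colourings and graphs

length-filter-tabulate : ∀ {a p} {A : Set a} {P : Pred A p} (P? : Decidable P) {n} (g : Fin n → A) →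
  length (filter P? (tabulate g)) ≡ count (does ∘ P? ∘ g)
length-filter-tabulate P? {zero}  g = refl
length-filter-tabulate P? {suc n} g with does (P? (g zero))
... | true  = cong suc (length-filter-tabulate P? (g ∘ suc))
... | false = length-filter-tabulate P? (g ∘ suc)

length-filter-concatMap-tabulate : ∀ {a b p} {A : Set a} {B : Set b} {P : Pred B p} (P? : Decidable P)
  (f : A → List B) {n} (g : Fin n → A) →
  length (filter P? (concatMap f (tabulate g))) ≡ ∑[ i < n ] length (filter P? (f (g i)))
length-filter-concatMap-tabulate P? f {zero}  g = refl
length-filter-concatMap-tabulate P? f {suc n} g = begin
  length (filter P? (f (g zero) ++ concatMap f (tabulate (g ∘ suc))))
    ≡⟨ cong length (filter-++ P? (f (g zero)) _) ⟩
  length (filter P? (f (g zero)) ++ filter P? (concatMap f (tabulate (g ∘ suc))))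
    ≡⟨ length-++ (filter P? (f (g zero))) ⟩
  length (filter P? (f (g zero))) + length (filter P? (concatMap f (tabulate (g ∘ suc))))
    ≡⟨ cong (length (filter P? (f (g zero))) +_) (length-filter-concatMap-tabulate P? f (g ∘ suc)) ⟩
  ∑[ i < suc n ] length (filter P? (f (g i))) ∎
  where open ≡-Reasoning

sumˡ-map-tabulate : ∀ {a} {A : Set a} (h : A → ℕ) {n} (g : Fin n → A) → sumˡ (map h (tabulate g)) ≡ sum (h ∘ g)
sumˡ-map-tabulate h {zero}  g = refl
sumˡ-map-tabulate h {suc n} g = cong (h (g zero) +_) (sumˡ-map-tabulate h (g ∘ suc))

∣tabulate∣≡count : ∀ {n} (P : Fin n → Bool) → ∣ Vec.tabulate P ∣ ≡ count P
∣tabulate∣≡count {zero}  P = refl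
∣tabulate∣≡count {suc n} P with P zero
... | true  = cong suc (∣tabulate∣≡count (P ∘ suc))
... | false = ∣tabulate∣≡count (P ∘ suc)

Edge : ∀ {n k} → Colouring n k → Fin k → Fin n → Fin n → Bool
Edge c i u v = does ((toℕ u <? toℕ v) ×-dec (col c u v ≟ i))

colourCount≡∑∑ : ∀ {n k} (c : Colouring n k) i → colourCount c i ≡ ∑[ u < n ] count (Edge c i u)
colourCount≡∑∑ {n} c i = begin
  colourCount c i
    ≡⟨ length-filter-concatMap-tabulate P? (λ u → map (u ,_) (allFin n)) id ⟩
  ∑[ u < n ] length (filter P? (map (u ,_) (tabulate id)))
    ≡⟨ sum-cong-≗ (λ u → cong (length ∘ filter P?) (map-tabulate id (u ,_))) ⟩
  ∑[ u < n ] length (filter P? (tabulate (u ,_)))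
    ≡⟨ sum-cong-≗ (λ u → length-filter-tabulate P? (u ,_)) ⟩
  ∑[ u < n ] count (Edge c i u) ∎
  where
  open ≡-Reasoning
  P? = λ (p : Fin n × Fin n) → (toℕ (proj₁ p) <? toℕ (proj₂ p)) ×-dec (col c (proj₁ p) (proj₂ p) ≟ i)

adj⇒≢ : ∀ {m} (H : Graph m) {u v} → adj H u v ≡ true → u ≢ v
adj⇒≢ H {u} uv refl rewrite irrefl H u with () ← uv

-- Upper bound

TwoForward : ∀ {n k} → Colouring n k → Set
TwoForward {k = k} c = ∀ u → ∃₂ λ (α β : Fin k) → ∀ v → toℕ u < toℕ v → col c u v ≡ α ⊎ col c u v ≡ β

-- In a subgraph, the vertex placed first by the embedding sees only forward edges, each of
-- them coloured α or β, and a rainbow copy uses each colour at most once.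
rainbow⇒2-degenerate : ∀ {m n k} (H : Graph m) (c : Colouring n k) → TwoForward c →
  ContainsRainbow H c → Degenerate 2 H
rainbow⇒2-degenerate {m} {k = k} H c twoForward (φ , φ-inj , rainbow) S F (_ , F⊆H) S≢∅
  with v , v∈S , v-first ← argmin (_∈? S) (toℕ ∘ φ) S≢∅
  with α , β , forward ← twoForward (φ v) = v , v∈S , degree≤2
  where
  after : ∀ u → F v u ≡ true → toℕ (φ v) < toℕ (φ u)
  after u Fvu with vu , _ , u∈S ← F⊆H v u Fvu =
    ≤∧≢⇒< (v-first u u∈S) (λ eq → adj⇒≢ H vu (φ-inj (toℕ-injective eq)))

  ofColour : Fin k → Fin m → Bool
  ofColour γ u = F v u ∧ does (col c (φ v) (φ u) ≟ γ)

  ofColour≤1 : ∀ γ → count (ofColour γ) ≤ 1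
  ofColour≤1 γ = count-≤1 (ofColour γ) unique
    where
    unique : ∀ u u′ → ofColour γ u ≡ true → ofColour γ u′ ≡ true → u ≡ u′
    unique u u′ Pu Pu′ with Fvu , γu ← ∧-true {F v u} Pu | Fvu′ , γu′ ← ∧-true {F v u′} Pu′
      with rainbow v u v u′ (proj₁ (F⊆H v u Fvu)) (proj₁ (F⊆H v u′ Fvu′))
             (trans (does-true (_ ≟ γ) γu) (sym (does-true (_ ≟ γ) γu′)))
    ... | inj₁ (_ , u≡u′) = u≡u′
    ... | inj₂ (_ , u≡v)  = ⊥-elim (adj⇒≢ H (proj₁ (F⊆H v u Fvu)) (sym u≡v))

  ofα∨β : ∀ u → F v u ≡ true → ofColour α u ∨ ofColour β u ≡ true
  ofα∨β u Fvu rewrite Fvu with forward (φ u) (after u Fvu)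
  ... | inj₁ ≡α rewrite ≡α | dec-true (α ≟ α) refl = refl
  ... | inj₂ ≡β rewrite ≡β | dec-true (β ≟ β) refl = Bool.∨-zeroʳ _

  degree≤2 : degreeIn F v ≤ 2
  degree≤2 = begin
    degreeIn F v                              ≡⟨ ∣tabulate∣≡count (F v) ⟩
    count (F v)                               ≤⟨ count-mono ofα∨β ⟩
    count (λ u → ofColour α u ∨ ofColour β u) ≤⟨ count-∨ (ofColour α) (ofColour β) ⟩
    count (ofColour α) + count (ofColour β)   ≤⟨ +-mono-≤ (ofColour≤1 α) (ofColour≤1 β) ⟩
    2                                         ∎
    where open ≤-Reasoning

extend : ∀ {n k} → Colouring n (suc k) → (Fin n → Fin (suc k)) → Colouring (suc n) (suc k)
extend {n} {k} c r = record { col = colour ; col-sym = colour-sym }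
  where
  colour : Fin (suc n) → Fin (suc n) → Fin (suc k)
  colour zero    zero    = zero
  colour zero    (suc t) = r t
  colour (suc u) zero    = r u
  colour (suc u) (suc v) = col c u v
  colour-sym : ∀ u v → colour u v ≡ colour v u
  colour-sym zero    zero    = refl
  colour-sym zero    (suc v) = refl
  colour-sym (suc u) zero    = refl
  colour-sym (suc u) (suc v) = col-sym c u v

extend-twoForward : ∀ {n k} {c : Colouring n (suc k)} {r} α β → TwoForward c →
  (∀ t → r t ≡ α ⊎ r t ≡ β) → TwoForward (extend c r)
extend-twoForward α β twoForward r∈αβ zero    = α , β , λ { (suc t) _ → r∈αβ t }
extend-twoForward α β twoForward r∈αβ (suc u) with α′ , β′ , forward ← twoForward u =
  α′ , β′ , λ { (suc v) (s≤s u<v) → forward v u<v }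

cone : ∀ {n K} → Fin K → Fin K → ℕ → Fin n → Fin K
cone α β j t = if toℕ t <ᵇ j then α else β

cone∈αβ : ∀ {n K} (α β : Fin K) j (t : Fin n) → cone α β j t ≡ α ⊎ cone α β j t ≡ β
cone∈αβ α β j t with toℕ t <ᵇ j
... | true  = inj₁ refl
... | false = inj₂ refl

coneCount : ∀ {K} → Fin K → Fin K → ℕ → ℕ → Fin K → ℕ
coneCount α β j n i = 𝟙 (does (α ≟ i)) * j + 𝟙 (does (β ≟ i)) * (n ∸ j)

count-cone : ∀ {K} (α β i : Fin K) n j → j ≤ n → count (λ t → does (cone {n} α β j t ≟ i)) ≡ coneCount α β j n i
count-cone α β i zero    zero    _ = sym (cong₂ _+_ (*-zeroʳ (𝟙 (does (α ≟ i)))) (*-zeroʳ (𝟙 (does (β ≟ i)))))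
count-cone α β i (suc n) zero    _ = begin
  b + count (λ t → does (cone {n} α β 0 t ≟ i)) ≡⟨ cong (b +_) (count-cone α β i n 0 z≤n) ⟩
  b + (a * 0 + b * n)                           ≡⟨ cong (λ x → b + (x + b * n)) (*-zeroʳ a) ⟩
  b + b * n                                     ≡⟨ sym (*-suc b n) ⟩
  b * suc n                                     ≡⟨ cong (_+ b * suc n) (sym (*-zeroʳ a)) ⟩
  a * 0 + b * suc n                             ∎
  where
  open ≡-Reasoning
  a = 𝟙 (does (α ≟ i))
  b = 𝟙 (does (β ≟ i))
count-cone α β i (suc n) (suc j) (s≤s j≤n) = begin
  a + count (λ t → does (cone {n} α β j t ≟ i)) ≡⟨ cong (a +_) (count-cone α β i n j j≤n) ⟩
  a + (a * j + b * (n ∸ j))                     ≡⟨ sym (+-assoc a _ _) ⟩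
  a + a * j + b * (n ∸ j)                       ≡⟨ cong (_+ b * (n ∸ j)) (sym (*-suc a j)) ⟩
  a * suc j + b * (n ∸ j)                       ∎
  where
  open ≡-Reasoning
  a = 𝟙 (does (α ≟ i))
  b = 𝟙 (does (β ≟ i))

sum-coneCount : ∀ {K} (α β : Fin K) j n → j ≤ n → sum (coneCount α β j n) ≡ n
sum-coneCount α β j n j≤n = begin
  sum (coneCount α β j n)
    ≡⟨ ∑-distrib-+ (λ i → 𝟙 (does (α ≟ i)) * j) _ ⟩
  sum (λ i → 𝟙 (does (α ≟ i)) * j) + sum (λ i → 𝟙 (does (β ≟ i)) * (n ∸ j))
    ≡⟨ cong₂ _+_ (count-*ʳ (λ i → does (α ≟ i)) j) (count-*ʳ (λ i → does (β ≟ i)) (n ∸ j)) ⟩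
  count (λ i → does (α ≟ i)) * j + count (λ i → does (β ≟ i)) * (n ∸ j)
    ≡⟨ cong₂ (λ x y → x * j + y * (n ∸ j)) (count-≟ α) (count-≟ β) ⟩
  1 * j + 1 * (n ∸ j)
    ≡⟨ cong₂ _+_ (*-identityˡ j) (*-identityˡ (n ∸ j)) ⟩
  j + (n ∸ j)
    ≡⟨ m+[n∸m]≡n j≤n ⟩
  n ∎
  where open ≡-Reasoning

[1+n]C2≡n+nC2 : ∀ n → suc n C 2 ≡ n + n C 2
[1+n]C2≡n+nC2 n = trans (sym (nCk+nC[k+1]≡[n+1]C[k+1] n 1)) (cong (_+ n C 2) (nC1≡n n))

2*[1+n]C2≡[1+n]*n : ∀ n → 2 * (suc n C 2) ≡ suc n * n
2*[1+n]C2≡[1+n]*n zero    = refl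
2*[1+n]C2≡[1+n]*n (suc n) = begin
  2 * (suc (suc n) C 2)       ≡⟨ cong (2 *_) ([1+n]C2≡n+nC2 (suc n)) ⟩
  2 * (suc n + suc n C 2)     ≡⟨ *-distribˡ-+ 2 (suc n) _ ⟩
  2 * suc n + 2 * (suc n C 2) ≡⟨ cong (2 * suc n +_) (2*[1+n]C2≡[1+n]*n n) ⟩
  2 * suc n + suc n * n       ≡⟨ ring n ⟩
  suc (suc n) * suc n         ∎
  where
  open ≡-Reasoning
  ring : ∀ n → 2 * suc n + suc n * n ≡ suc (suc n) * suc n
  ring = solve-∀

positive : ℕ → Bool
positive zero    = false
positive (suc _) = true

-- the number of colours that still have edges to be placed
support : ∀ {K} → (Fin K → ℕ) → ℕ
support e = count (positive ∘ e)

positive-∸ : ∀ x y → positive (x ∸ y) ≡ true → positive x ≡ true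
positive-∸ zero    y p rewrite 0∸n≡0 y = p
positive-∸ (suc x) y _ = refl

support-∸-≤ : ∀ {K} (e s : Fin K → ℕ) → support (λ i → e i ∸ s i) ≤ support e
support-∸-≤ e s = count-mono (λ i → positive-∸ (e i) (s i))

support-∸-< : ∀ {K} (e s : Fin K → ℕ) a → 0 < e a → e a ≤ s a → support (λ i → e i ∸ s i) < support e
support-∸-< e s a 0<ea ea≤sa = count-< (λ i → positive-∸ (e i) (s i)) a emptied (positive-suc 0<ea)
  where
  emptied : positive (e a ∸ s a) ≡ false
  emptied rewrite m≤n⇒m∸n≡0 ea≤sa = refl
  positive-suc : ∀ {x} → 0 < x → positive x ≡ true
  positive-suc (s≤s _) = refl

sum≤support* : ∀ {K} (e : Fin K → ℕ) x → (∀ i → 0 < e i → e i ≤ x) → sum e ≤ support e * x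
sum≤support* e x bounded = ≤-trans (sum-mono-≤ pointwise) (≤-reflexive (count-*ʳ (positive ∘ e) x))
  where
  pointwise : ∀ i → e i ≤ 𝟙 (positive (e i)) * x
  pointwise i with e i | bounded i
  ... | zero  | _     = z≤n
  ... | suc y | ei≤x = ≤-trans (ei≤x (s≤s z≤n)) (≤-reflexive (sym (+-identityʳ x)))

support*≤sum : ∀ {K} (e : Fin K → ℕ) x → (∀ i → 0 < e i → x ≤ e i) → support e * x ≤ sum e
support*≤sum e x bounded = ≤-trans (≤-reflexive (sym (count-*ʳ (positive ∘ e) x))) (sum-mono-≤ pointwise)
  where
  pointwise : ∀ i → 𝟙 (positive (e i)) * x ≤ e i
  pointwise i with e i | bounded i
  ... | zero  | _     = z≤n
  ... | suc y | x≤ei = ≤-trans (≤-reflexive (+-identityʳ x)) (x≤ei (s≤s z≤n))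

large-colour : ∀ {K} n (e : Fin K → ℕ) → sum e ≡ suc n C 2 → 2 * support e ≤ suc n → 0 < n →
  ∃ λ b → n ≤ e b
large-colour n e Σe few 0<n with any? (λ b → n ≤? e b)
... | yes large = large
... | no ¬large = ⊥-elim (<-irrefl refl (<-≤-trans (pred[n]<n 0<n) (*-cancelˡ-≤ (suc n) (begin
  suc n * n                 ≡⟨ sym (2*[1+n]C2≡[1+n]*n n) ⟩
  2 * (suc n C 2)           ≡⟨ cong (2 *_) (sym Σe) ⟩
  2 * sum e                 ≤⟨ *-monoʳ-≤ 2 (sum≤support* e (pred n) small) ⟩
  2 * (support e * pred n)  ≡⟨ sym (*-assoc 2 (support e) (pred n)) ⟩
  2 * support e * pred n    ≤⟨ *-monoˡ-≤ (pred n) few ⟩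
  suc n * pred n            ∎))))
  where
  open ≤-Reasoning
  pred[n]<n : ∀ {n} → 0 < n → pred n < n
  pred[n]<n (s≤s _) = ≤-refl
  small : ∀ i → 0 < e i → e i ≤ pred n
  small i _ = <⇒≤pred (≰⇒> (λ n≤ei → ¬large (i , n≤ei)))

support-of-large : ∀ {K} n (e : Fin K → ℕ) → sum e ≡ suc n C 2 → (∀ i → 0 < e i → n < e i) → 2 * support e ≤ n
support-of-large n e Σe large = *-cancelʳ-≤ (2 * support e) n (suc n) (begin
  2 * support e * suc n     ≡⟨ *-assoc 2 (support e) (suc n) ⟩
  2 * (support e * suc n)   ≤⟨ *-monoʳ-≤ 2 (support*≤sum e (suc n) large) ⟩
  2 * sum e                 ≡⟨ cong (2 *_) Σe ⟩
  2 * (suc n C 2)           ≡⟨ 2*[1+n]C2≡[1+n]*n n ⟩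
  suc n * n                 ≡⟨ *-comm (suc n) n ⟩
  n * suc n                 ∎)
  where open ≤-Reasoning

zero-distribution : ∀ {K} n (e : Fin K → ℕ) → sum e ≡ suc n C 2 → (∀ i → e i ≡ 0) → n ≡ 0
zero-distribution {K} n e Σe e≡0 with m*n≡0⇒m≡0∨n≡0 (suc n) (begin
  suc n * n       ≡⟨ sym (2*[1+n]C2≡[1+n]*n n) ⟩
  2 * (suc n C 2) ≡⟨ cong (2 *_) (sym Σe) ⟩
  2 * sum e       ≡⟨ cong (2 *_) (trans (sum-cong-≗ e≡0) (trans (sum-const K 0) (*-zeroʳ K))) ⟩
  0               ∎)
  where open ≡-Reasoning
... | inj₂ n≡0 = n≡0

coneCount-α : ∀ {K} (α β : Fin K) j n → j ≤ coneCount α β j n α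
coneCount-α α β j n rewrite dec-true (α ≟ α) refl = ≤-trans (≤-reflexive (sym (*-identityˡ j))) (m≤m+n _ _)

no-positive⇒≡0 : ∀ {K} {e : Fin K → ℕ} → ¬ (∃ λ i → 0 < e i) → ∀ i → e i ≡ 0
no-positive⇒≡0 ¬positive i = n≤0⇒n≡0 (≮⇒≥ (λ 0<ei → ¬positive (i , 0<ei)))

-- How to colour the n forward edges of the first vertex of K_(n+1): j of them α, the rest β.
record ConeChoice (n : ℕ) {K} (e : Fin K → ℕ) : Set where
  field
    α β    : Fin K
    j      : ℕ
    j≤n    : j ≤ n
    cone≤e : ∀ i → coneCount α β j n i ≤ e i
    rest-support : 2 * support (λ i → e i ∸ coneCount α β j n i) ≤ n

cone-choice-small : ∀ {K} n (e : Fin K → ℕ) a b → 0 < e a → e a ≤ n → n ≤ e b → 2 * support e ≤ suc n →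
  ConeChoice n e
cone-choice-small n e a b 0<ea ea≤n n≤eb few = record
  { α = a ; β = b ; j = e a ; j≤n = ea≤n ; cone≤e = cone≤e ; rest-support = emptying }
  where
  cone≤e : ∀ i → coneCount a b (e a) n i ≤ e i
  cone≤e i with a ≟ i | b ≟ i
  ... | yes refl | yes refl =
    ≤-trans (≤-reflexive (trans (cong₂ _+_ (*-identityˡ (e a)) (*-identityˡ (n ∸ e a))) (m+[n∸m]≡n ea≤n))) n≤eb
  ... | yes refl | no _     = ≤-reflexive (trans (cong₂ _+_ (*-identityˡ (e a)) refl) (+-identityʳ (e a)))
  ... | no _     | yes refl = ≤-trans (≤-reflexive (*-identityˡ (n ∸ e a))) (≤-trans (m∸n≤m n (e a)) n≤eb)
  ... | no _     | no _     = z≤n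
  rest = λ i → e i ∸ coneCount a b (e a) n i
  emptying : 2 * support rest ≤ n
  emptying = <⇒≤ (≤-pred (begin
    suc (suc (2 * support rest)) ≡⟨ sym (*-suc 2 (support rest)) ⟩
    2 * suc (support rest)       ≤⟨ *-monoʳ-≤ 2 (support-∸-< e (coneCount a b (e a) n) a 0<ea (coneCount-α a b (e a) n)) ⟩
    2 * support e                ≤⟨ few ⟩
    suc n                        ∎))
    where open ≤-Reasoning

cone-choice-large : ∀ {K} n (e : Fin K → ℕ) b → 0 < e b → (∀ i → 0 < e i → n < e i) → sum e ≡ suc n C 2 →
  ConeChoice n e
cone-choice-large n e b 0<eb large Σe = record
  { α = b ; β = b ; j = n ; j≤n = ≤-refl ; cone≤e = cone≤e
  ; rest-support = ≤-trans (*-monoʳ-≤ 2 (support-∸-≤ e (coneCount b b n n))) (support-of-large n e Σe large) }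
  where
  cone≤e : ∀ i → coneCount b b n n i ≤ e i
  cone≤e i with b ≟ i
  ... | yes refl = ≤-trans (≤-reflexive (trans (cong₂ _+_ (*-identityˡ n) (trans (*-identityˡ _) (n∸n≡0 n))) (+-identityʳ n)))
                     (<⇒≤ (large b 0<eb))
  ... | no _     = z≤n

cone-choice-zero : ∀ {k} (e : Fin (suc k) → ℕ) → (∀ i → e i ≡ 0) → ConeChoice 0 e
cone-choice-zero e e≡0 = record
  { α = zero ; β = zero ; j = 0 ; j≤n = z≤n
  ; cone≤e = λ i → ≤-reflexive (trans (cong₂ _+_ (*-zeroʳ (𝟙 (does (zero ≟ i)))) (*-zeroʳ (𝟙 (does (zero ≟ i)))))
                                       (sym (e≡0 i)))
  ; rest-support = ≤-reflexive (cong (2 *_) (count-≡0 _ (λ i → cong positive (trans (cong (_∸ 0) (e≡0 i)) refl)))) }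

-- Either some colour with 0 < e a ≤ n can be used up (with a colour of at least n edges for the
-- remaining cone edges), or every colour in use has more than n edges and one of them fills the cone.
cone-choice : ∀ {k} n (e : Fin (suc k) → ℕ) → sum e ≡ suc n C 2 → 2 * support e ≤ suc n → ConeChoice n e
cone-choice n e Σe few with any? (λ a → (0 <? e a) ×-dec (e a ≤? n))
... | yes (a , 0<ea , ea≤n) with b , n≤eb ← large-colour n e Σe few (<-≤-trans 0<ea ea≤n) =
  cone-choice-small n e a b 0<ea ea≤n n≤eb few
... | no ¬small with any? (λ b → 0 <? e b)
...   | yes (b , 0<eb) = cone-choice-large n e b 0<eb (λ i 0<ei → ≰⇒> (λ ei≤n → ¬small (i , 0<ei , ei≤n))) Σe
...   | no ¬positive with refl ← zero-distribution n e Σe (no-positive⇒≡0 ¬positive) =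
  cone-choice-zero e (no-positive⇒≡0 ¬positive)

twoForward-colouring : ∀ {k} n (e : Fin (suc k) → ℕ) → sum e ≡ n C 2 → 2 * support e ≤ n →
  Σ (Colouring n (suc k)) λ c → (∀ i → ∑[ u < n ] count (Edge c i u) ≡ e i) × TwoForward c
twoForward-colouring zero e Σe _ =
  record { col = λ () ; col-sym = λ () } , (λ i → sym (n≤0⇒n≡0 (≤-trans (≤-sum e i) (≤-reflexive Σe)))) , λ ()
twoForward-colouring {k} (suc n) e Σe few =
  extend c (cone α β j) , counts , extend-twoForward α β twoForward (cone∈αβ α β j)
  where
  open ConeChoice (cone-choice n e Σe few)
  rest : Fin (suc k) → ℕ
  rest i = e i ∸ coneCount α β j n i
  Σrest : sum rest ≡ n C 2
  Σrest = +-cancelˡ-≡ n _ _ (begin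
    n + sum rest                         ≡⟨ cong (_+ sum rest) (sym (sum-coneCount α β j n j≤n)) ⟩
    sum (coneCount α β j n) + sum rest   ≡⟨ sym (∑-distrib-+ (coneCount α β j n) rest) ⟩
    ∑[ i < suc k ] (coneCount α β j n i + rest i) ≡⟨ sum-cong-≗ (λ i → m+[n∸m]≡n (cone≤e i)) ⟩
    sum e                                ≡⟨ Σe ⟩
    suc n C 2                            ≡⟨ [1+n]C2≡n+nC2 n ⟩
    n + n C 2                            ∎)
    where open ≡-Reasoning
  recursive = twoForward-colouring n rest Σrest rest-support
  c = proj₁ recursive
  twoForward = proj₂ (proj₂ recursive)
  counts : ∀ i → ∑[ u < suc n ] count (Edge (extend c (cone α β j)) i u) ≡ e i
  counts i = begin
    count (λ t → does (cone {n} α β j t ≟ i)) + ∑[ u < n ] count (Edge c i u)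
      ≡⟨ cong₂ _+_ (count-cone α β i n j j≤n) (proj₁ (proj₂ recursive) i) ⟩
    coneCount α β j n i + rest i
      ≡⟨ m+[n∸m]≡n (cone≤e i) ⟩
    e i ∎
    where open ≡-Reasoning

g≤2k : ∀ {m} (H : Graph m) → ¬ Degenerate 2 H → ∀ k → 1 ≤ k → gAtMost H k (2 * k)
g≤2k H ¬2-degenerate (suc k) _ n 2k≤n e Σe = c , distribution , rainbowFree
  where
  colouring = twoForward-colouring n e (trans (sym (sumˡ-map-tabulate e id)) Σe)
                (≤-trans (*-monoʳ-≤ 2 (count≤n (positive ∘ e))) 2k≤n)
  c = proj₁ colouring
  distribution : HasDistribution c e
  distribution i = trans (colourCount≡∑∑ c i) (proj₁ (proj₂ colouring) i)
  rainbowFree : RainbowFree H c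
  rainbowFree rainbow = ¬2-degenerate (rainbow⇒2-degenerate H c (proj₂ (proj₂ colouring)) rainbow)

-- Lower bound

module _ {n k} (c : Colouring n k) where

  Edge-true : ∀ {γ x w} → toℕ x < toℕ w → col c x w ≡ γ → Edge c γ x w ≡ true
  Edge-true {γ} {x} {w} x<w xw≡γ = dec-true ((toℕ x <? toℕ w) ×-dec (col c x w ≟ γ)) (x<w , xw≡γ)

  -- the diagonal entry col c x x is junk and may carry colour γ: hence the 𝟙 (w ≟ x)
  𝟙-colour≤ : ∀ γ x w → 𝟙 (does (col c x w ≟ γ)) ≤ 𝟙 (Edge c γ x w) + 𝟙 (Edge c γ w x) + 𝟙 (does (w ≟ x))
  𝟙-colour≤ γ x w = 𝟙-≤ (λ p → counted (does-true (col c x w ≟ γ) p))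
    where
    counted : col c x w ≡ γ → 1 ≤ 𝟙 (Edge c γ x w) + 𝟙 (Edge c γ w x) + 𝟙 (does (w ≟ x))
    counted xw≡γ with <-cmp (toℕ x) (toℕ w)
    ... | tri< x<w _ _ = ≤-trans (≤-reflexive (cong 𝟙 (sym (Edge-true x<w xw≡γ)))) (≤-trans (m≤m+n _ _) (m≤m+n _ _))
    ... | tri≈ _ x≡w _ = ≤-trans (≤-reflexive (cong 𝟙 (sym (dec-true (w ≟ x) (sym (toℕ-injective x≡w)))))) (m≤n+m _ _)
    ... | tri> _ _ w<x = ≤-trans (≤-reflexive (cong 𝟙 (sym (Edge-true w<x (trans (col-sym c w x) xw≡γ)))))
                                 (≤-trans (m≤n+m _ (𝟙 (Edge c γ x w))) (m≤m+n _ _))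

  row≤colourCount : ∀ γ x → count (Edge c γ x) ≤ colourCount c γ
  row≤colourCount γ x = ≤-trans (≤-sum (λ u → count (Edge c γ u)) x) (≤-reflexive (sym (colourCount≡∑∑ c γ)))

  column≤colourCount : ∀ γ x → count (λ w → Edge c γ w x) ≤ colourCount c γ
  column≤colourCount γ x = ≤-trans (sum-mono-≤ (λ w → ≤-sum (𝟙 ∘ Edge c γ w) x)) (≤-reflexive (sym (colourCount≡∑∑ c γ)))

  colour-degree≤ : ∀ b → (∀ γ → colourCount c γ ≤ b) → ∀ x γ → count (λ w → does (col c x w ≟ γ)) ≤ 2 * b + 1
  colour-degree≤ b small x γ = begin
    count (λ w → does (col c x w ≟ γ))
      ≤⟨ sum-mono-≤ (𝟙-colour≤ γ x) ⟩
    ∑[ w < n ] (𝟙 (Edge c γ x w) + 𝟙 (Edge c γ w x) + 𝟙 (does (w ≟ x)))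
      ≡⟨ trans (∑-distrib-+ (λ w → 𝟙 (Edge c γ x w) + 𝟙 (Edge c γ w x)) _)
               (cong (_+ _) (∑-distrib-+ (𝟙 ∘ Edge c γ x) _)) ⟩
    count (Edge c γ x) + count (λ w → Edge c γ w x) + count (λ w → does (w ≟ x))
      ≤⟨ +-mono-≤ (+-mono-≤ (≤-trans (row≤colourCount γ x) (small γ)) (≤-trans (column≤colourCount γ x) (small γ)))
                  (count-≡-≤1 x) ⟩
    b + b + 1
      ≡⟨ cong (λ y → b + y + 1) (sym (+-identityʳ b)) ⟩
    2 * b + 1 ∎
    where open ≤-Reasoning

  colour-degree≤′ : ∀ b → (∀ γ → colourCount c γ ≤ b) → ∀ x γ → count (λ w → does (col c w x ≟ γ)) ≤ 2 * b + 1
  colour-degree≤′ b small x γ =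
    ≤-trans (≤-reflexive (sum-cong-≗ (λ w → cong (λ γ′ → 𝟙 (does (γ′ ≟ γ))) (col-sym c w x)))) (colour-degree≤ b small x γ)

SameEdge : ∀ {j} → Fin j → Fin j → Fin j → Fin j → Set
SameEdge a b a′ b′ = (a ≡ a′ × b ≡ b′) ⊎ (a ≡ b′ × b ≡ a′)

module _ {n k} (c : Colouring n k) where

  -- w can be added in front of the rainbow clique φ
  record Fresh {j} (w : Fin n) (φ : Fin j → Fin n) : Set where
    field
      new      : ∀ i → w ≢ φ i
      distinct : ∀ i i′ → col c w (φ i) ≡ col c w (φ i′) → i ≡ i′
      unused   : ∀ i a b → a ≢ b → col c w (φ i) ≢ col c (φ a) (φ b)

  RainbowClique : ∀ {j} → (Fin j → Fin n) → Set
  RainbowClique {zero}  φ = ⊤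
  RainbowClique {suc j} φ = RainbowClique (tail φ) × Fresh (head φ) (tail φ)

  rainbowClique-injective : ∀ {j} (φ : Fin j → Fin n) → RainbowClique φ → ∀ a b → φ a ≡ φ b → a ≡ b
  rainbowClique-injective φ _              zero    zero    _ = refl
  rainbowClique-injective φ (_ , fresh)    zero    (suc b) e = ⊥-elim (Fresh.new fresh b e)
  rainbowClique-injective φ (_ , fresh)    (suc a) zero    e = ⊥-elim (Fresh.new fresh a (sym e))
  rainbowClique-injective φ (clique , _)   (suc a) (suc b) e = cong suc (rainbowClique-injective (tail φ) clique a b e)

  rainbowClique-rainbow : ∀ {j} (φ : Fin j → Fin n) → RainbowClique φ →
    ∀ a b a′ b′ → a ≢ b → a′ ≢ b′ → col c (φ a) (φ b) ≡ col c (φ a′) (φ b′) → SameEdge a b a′ b′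
  rainbowClique-rainbow {suc j} φ (clique , fresh) = same
    where
    open Fresh fresh
    flip : ∀ {a b a′ b′ : Fin (suc j)} → SameEdge a b a′ b′ → SameEdge b a a′ b′
    flip (inj₁ (p , q)) = inj₂ (q , p)
    flip (inj₂ (p , q)) = inj₁ (q , p)
    swap : ∀ {a b a′ b′ : Fin (suc j)} → SameEdge a b a′ b′ → SameEdge a′ b′ a b
    swap (inj₁ (p , q)) = inj₁ (sym p , sym q)
    swap (inj₂ (p , q)) = inj₂ (sym q , sym p)
    fromHead : ∀ b a′ b′ → zero ≢ b → a′ ≢ b′ → col c (φ zero) (φ b) ≡ col c (φ a′) (φ b′) → SameEdge zero b a′ b′
    fromHead zero    _        _        0≢0 _ _ = ⊥-elim (0≢0 refl)
    fromHead (suc b) zero     zero     _ 0≢0 _ = ⊥-elim (0≢0 refl)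
    fromHead (suc b) zero     (suc b′) _ _ e = inj₁ (refl , cong suc (distinct b b′ e))
    fromHead (suc b) (suc a′) zero     _ _ e = inj₂ (refl , cong suc (distinct b a′ (trans e (col-sym c _ _))))
    fromHead (suc b) (suc a′) (suc b′) _ a′≢b′ e = ⊥-elim (unused b a′ b′ (a′≢b′ ∘ cong suc) e)
    same : ∀ a b a′ b′ → a ≢ b → a′ ≢ b′ → col c (φ a) (φ b) ≡ col c (φ a′) (φ b′) → SameEdge a b a′ b′
    same zero    b       a′       b′       a≢b a′≢b′ e = fromHead b a′ b′ a≢b a′≢b′ e
    same (suc a) zero    a′       b′       a≢b a′≢b′ e =
      flip (fromHead (suc a) a′ b′ (a≢b ∘ sym) a′≢b′ (trans (col-sym c _ _) e))
    same (suc a) (suc b) zero     b′       a≢b a′≢b′ e = swap (fromHead b′ (suc a) (suc b) a′≢b′ a≢b (sym e))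
    same (suc a) (suc b) (suc a′) zero     a≢b a′≢b′ e =
      swap (flip (fromHead (suc a′) (suc a) (suc b) (a′≢b′ ∘ sym) a≢b (trans (col-sym c _ _) (sym e))))
    same (suc a) (suc b) (suc a′) (suc b′) a≢b a′≢b′ e
      with rainbowClique-rainbow (tail φ) clique a b a′ b′ (a≢b ∘ cong suc) (a′≢b′ ∘ cong suc) e
    ... | inj₁ (p , q) = inj₁ (cong suc p , cong suc q)
    ... | inj₂ (p , q) = inj₂ (cong suc p , cong suc q)

  rainbowClique⇒rainbow : ∀ {m} (H : Graph m) (φ : Fin m → Fin n) → RainbowClique φ → ContainsRainbow H c
  rainbowClique⇒rainbow H φ clique =
    φ , (λ {a} {b} → rainbowClique-injective φ clique a b) ,
    λ a b a′ b′ ab a′b′ → rainbowClique-rainbow φ clique a b a′ b′ (adj⇒≢ H ab) (adj⇒≢ H a′b′)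

-- v itself, 2jD repeats (on average) and jD + 2j²D colour clashes
loss : ℕ → ℕ → ℕ
loss D j = 1 + (3 * j + 2 * (j * j)) * D

loss-mono : ∀ D {i j} → i ≤ j → loss D i ≤ loss D j
loss-mono D i≤j = +-monoʳ-≤ 1 (*-monoˡ-≤ D (+-mono-≤ (*-monoʳ-≤ 3 i≤j) (*-monoʳ-≤ 2 (*-mono-≤ i≤j i≤j))))

n≤2*w : ∀ {n w x} → n ≤ w + x → 2 * x ≤ n → n ≤ 2 * w
n≤2*w {n} {w} {x} n≤w+x 2x≤n = +-cancelʳ-≤ n n (2 * w) (begin
  n + n           ≡⟨ cong (n +_) (sym (+-identityʳ n)) ⟩
  2 * n           ≤⟨ *-monoʳ-≤ 2 n≤w+x ⟩
  2 * (w + x)     ≡⟨ *-distribˡ-+ 2 w x ⟩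
  2 * w + 2 * x   ≤⟨ +-monoʳ-≤ (2 * w) 2x≤n ⟩
  2 * w + n       ∎)
  where open ≤-Reasoning

1≤2*x⇒1≤x : ∀ {x} → 1 ≤ 2 * x → 1 ≤ x
1≤2*x⇒1≤x {suc x} _ = s≤s z≤n

module Greedy {n k} (c : Colouring n k) (b : ℕ) (small : ∀ γ → colourCount c γ ≤ b) where

  D : ℕ
  D = 2 * b + 1

  module _ {j} (φ : Fin j → Fin n) where

    repeats : Fin n → ℕ
    repeats v = ∑[ i < j ] count (λ w → does (col c w v ≟ col c w (φ i)))

    ∑repeats≤ : sum repeats ≤ j * (n * D)
    ∑repeats≤ = begin
      ∑[ v < n ] ∑[ i < j ] ∑[ w < n ] X v i w ≡⟨ ∑-comm (λ v i → ∑[ w < n ] X v i w) ⟩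
      ∑[ i < j ] ∑[ v < n ] ∑[ w < n ] X v i w ≡⟨ sum-cong-≗ (λ i → ∑-comm (λ v w → X v i w)) ⟩
      ∑[ i < j ] ∑[ w < n ] ∑[ v < n ] X v i w ≤⟨ sum-≤-* _ (n * D) (λ i → sum-≤-* _ D (λ w →
                                                   colour-degree≤ c b small w (col c w (φ i)))) ⟩
      j * (n * D)                            ∎
      where
      open ≤-Reasoning
      X : Fin n → Fin j → Fin n → ℕ
      X v i w = 𝟙 (does (col c w v ≟ col c w (φ i)))

    -- after v joins the clique, w is no longer a candidate
    Blocked : Fin n → Fin n → Set
    Blocked v w = w ≡ v
                ⊎ (∃ λ i → col c w v ≡ col c w (φ i))
                ⊎ (∃ λ i → col c w v ≡ col c v (φ i))
                ⊎ (∃₂ λ a a′ → col c w v ≡ col c (φ a) (φ a′))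
                ⊎ (∃₂ λ i i′ → col c w (φ i) ≡ col c v (φ i′))

    blocked? : ∀ v w → Dec (Blocked v w)
    blocked? v w = (w ≟ v)
                 ⊎-dec any? (λ i → col c w v ≟ col c w (φ i))
                 ⊎-dec any? (λ i → col c w v ≟ col c v (φ i))
                 ⊎-dec any? (λ a → any? λ a′ → col c w v ≟ col c (φ a) (φ a′))
                 ⊎-dec any? (λ i → any? λ i′ → col c w (φ i) ≟ col c v (φ i′))

    count-blocked : ∀ v → count (λ w → does (blocked? v w)) ≤ 1 + (repeats v + (j * D + (j * (j * D) + j * (j * D))))
    count-blocked v =
      ≤-trans (count-∨ isV (λ w → repeated w ∨ (sharesV w ∨ (sharesClique w ∨ crossing w)))) (+-mono-≤ (count-≡-≤1 v) (
      ≤-trans (count-∨ repeated (λ w → sharesV w ∨ (sharesClique w ∨ crossing w))) (+-mono-≤ repeated≤ (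
      ≤-trans (count-∨ sharesV (λ w → sharesClique w ∨ crossing w)) (+-mono-≤ sharesV≤ (
      ≤-trans (count-∨ sharesClique crossing) (+-mono-≤ sharesClique≤ crossing≤)))))))
      where
      isV repeated sharesV sharesClique crossing : Fin n → Bool
      isV w          = does (w ≟ v)
      repeated w     = does (any? λ i → col c w v ≟ col c w (φ i))
      sharesV w      = does (any? λ i → col c w v ≟ col c v (φ i))
      sharesClique w = does (any? λ a → any? λ a′ → col c w v ≟ col c (φ a) (φ a′))
      crossing w     = does (any? λ i → any? λ i′ → col c w (φ i) ≟ col c v (φ i′))
      repeated≤ : count repeated ≤ repeats v
      repeated≤ = count-any? (λ i w → col c w v ≟ col c w (φ i))
      sharesV≤ : count sharesV ≤ j * D
      sharesV≤ = ≤-trans (count-any? (λ i w → col c w v ≟ col c v (φ i)))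
                   (sum-≤-* _ D (λ i → colour-degree≤′ c b small v (col c v (φ i))))
      sharesClique≤ : count sharesClique ≤ j * (j * D)
      sharesClique≤ = count-any²? (λ a a′ w → col c w v ≟ col c (φ a) (φ a′)) D
                        (λ a a′ → colour-degree≤′ c b small v (col c (φ a) (φ a′)))
      crossing≤ : count crossing ≤ j * (j * D)
      crossing≤ = count-any²? (λ i i′ w → col c w (φ i) ≟ col c v (φ i′)) D
                    (λ i i′ → colour-degree≤′ c b small (φ i) (col c v (φ i′)))

    fresh-∷ : ∀ {v w} → Fresh c w φ → ¬ Blocked v w → Fresh c w (v ∷ φ)
    fresh-∷ {v} {w} fresh unblocked = record { new = new′ ; distinct = distinct′ ; unused = unused′ }
      where
      open Fresh fresh
      new′ : ∀ i → w ≢ (v ∷ φ) i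
      new′ zero    w≡v = unblocked (inj₁ w≡v)
      new′ (suc i)     = new i
      distinct′ : ∀ i i′ → col c w ((v ∷ φ) i) ≡ col c w ((v ∷ φ) i′) → i ≡ i′
      distinct′ zero    zero     _ = refl
      distinct′ zero    (suc i′) e = ⊥-elim (unblocked (inj₂ (inj₁ (i′ , e))))
      distinct′ (suc i) zero     e = ⊥-elim (unblocked (inj₂ (inj₁ (i , sym e))))
      distinct′ (suc i) (suc i′) e = cong suc (distinct i i′ e)
      unused′ : ∀ i a b → a ≢ b → col c w ((v ∷ φ) i) ≢ col c ((v ∷ φ) a) ((v ∷ φ) b)
      unused′ _       zero    zero    a≢b _ = a≢b refl
      unused′ zero    zero    (suc b) _   e = unblocked (inj₂ (inj₂ (inj₁ (b , e))))
      unused′ zero    (suc a) zero    _   e = unblocked (inj₂ (inj₂ (inj₁ (a , trans e (col-sym c _ _)))))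
      unused′ zero    (suc a) (suc b) _   e = unblocked (inj₂ (inj₂ (inj₂ (inj₁ (a , b , e)))))
      unused′ (suc i) zero    (suc b) _   e = unblocked (inj₂ (inj₂ (inj₂ (inj₂ (i , b , e)))))
      unused′ (suc i) (suc a) zero    _   e = unblocked (inj₂ (inj₂ (inj₂ (inj₂ (i , a , trans e (col-sym c _ _))))))
      unused′ (suc i) (suc a) (suc b) a≢b e = unused i a b (a≢b ∘ cong suc) e

  record Partial (j : ℕ) : Set where
    field
      φ          : Fin j → Fin n
      clique     : RainbowClique c φ
      candidates : Fin n → Bool
      fresh      : ∀ w → candidates w ≡ true → Fresh c w φ

  -- The candidate v with the fewest repeats loses at most the average, hence few candidates.
  step : ∀ {j} (s : Partial j) → 1 ≤ n → n ≤ 2 * count (Partial.candidates s) →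
    Σ (Partial (suc j)) λ s′ → count (Partial.candidates s) ≤ count (Partial.candidates s′) + loss D j
  step {j} record { φ = φ ; clique = clique ; candidates = W ; fresh = fresh } 1≤n half
    with v , Wv , v-min ← argmin (λ w → W w Bool.≟ true) (repeats φ) (1≤count⇒∃ W (1≤2*x⇒1≤x (≤-trans 1≤n half))) =
    record { φ = v ∷ φ ; clique = clique , fresh v Wv ; candidates = W′ ; fresh = fresh′ } , W≤W′+loss
    where
    W′ : Fin n → Bool
    W′ w = W w ∧ not (does (blocked? φ v w))

    fresh′ : ∀ w → W′ w ≡ true → Fresh c w (v ∷ φ)
    fresh′ w W′w with Ww , unblocked ← ∧-true {W w} W′w =
      fresh-∷ φ (fresh w Ww) (does-false (blocked? φ v w) (not-true unblocked))

    repeats≤ : repeats φ v ≤ 2 * (j * D)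
    repeats≤ = *-cancelˡ-≤ n {{>-nonZero 1≤n}} (begin
      n * repeats φ v               ≤⟨ *-monoˡ-≤ (repeats φ v) half ⟩
      2 * count W * repeats φ v     ≡⟨ *-assoc 2 (count W) (repeats φ v) ⟩
      2 * (count W * repeats φ v)   ≤⟨ *-monoʳ-≤ 2 (≤-trans (count*min≤sum W (repeats φ) v v-min) (∑repeats≤ φ)) ⟩
      2 * (j * (n * D))             ≡⟨ ring n j D ⟩
      n * (2 * (j * D))             ∎)
      where
      open ≤-Reasoning
      ring : ∀ n j D → 2 * (j * (n * D)) ≡ n * (2 * (j * D))
      ring = solve-∀

    W≤W′+loss : count W ≤ count W′ + loss D j
    W≤W′+loss = begin
      count W                                                      ≤⟨ count-mono kept∨blocked ⟩
      count (λ w → W′ w ∨ does (blocked? φ v w))                   ≤⟨ count-∨ W′ (λ w → does (blocked? φ v w)) ⟩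
      count W′ + count (λ w → does (blocked? φ v w))               ≤⟨ +-monoʳ-≤ (count W′) (count-blocked φ v) ⟩
      count W′ + (1 + (repeats φ v + (j * D + (j * (j * D) + j * (j * D)))))
        ≤⟨ +-monoʳ-≤ (count W′) (+-monoʳ-≤ 1 (+-monoˡ-≤ _ repeats≤)) ⟩
      count W′ + (1 + (2 * (j * D) + (j * D + (j * (j * D) + j * (j * D))))) ≡⟨ cong (count W′ +_) (ring j D) ⟩
      count W′ + loss D j                                          ∎
      where
      open ≤-Reasoning
      ring : ∀ j D → 1 + (2 * (j * D) + (j * D + (j * (j * D) + j * (j * D)))) ≡ 1 + (3 * j + 2 * (j * j)) * D
      ring = solve-∀
      kept∨blocked : ∀ w → W w ≡ true → (W′ w ∨ does (blocked? φ v w)) ≡ true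
      kept∨blocked w Ww rewrite Ww with does (blocked? φ v w)
      ... | true  = refl
      ... | false = refl

  module _ (m : ℕ) (1≤n : 1 ≤ n) (large : 2 * m * loss D m ≤ n) where

    2*jL≤n : ∀ {j} → j ≤ m → 2 * (j * loss D m) ≤ n
    2*jL≤n {j} j≤m =
      ≤-trans (≤-reflexive (sym (*-assoc 2 j (loss D m)))) (≤-trans (*-monoˡ-≤ (loss D m) (*-monoʳ-≤ 2 j≤m)) large)

    greedy : ∀ j → j ≤ m → Σ (Partial j) λ s → n ≤ count (Partial.candidates s) + j * loss D m
    greedy zero _ =
      record { φ = λ () ; clique = _ ; candidates = λ _ → true
             ; fresh = λ _ _ → record { new = λ () ; distinct = λ () ; unused = λ () } } ,
      ≤-reflexive (sym (trans (+-identityʳ _) (count-true n)))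
    greedy (suc j) j<m with s , n≤W+jL ← greedy j (<⇒≤ j<m) = s′ , (begin
      n                                       ≤⟨ n≤W+jL ⟩
      count W + j * L                         ≤⟨ +-monoˡ-≤ (j * L) W≤W′+loss ⟩
      count W′ + loss D j + j * L             ≤⟨ +-monoˡ-≤ (j * L) (+-monoʳ-≤ (count W′) (loss-mono D (<⇒≤ j<m))) ⟩
      count W′ + L + j * L                    ≡⟨ +-assoc (count W′) L (j * L) ⟩
      count W′ + suc j * L                    ∎)
      where
      open ≤-Reasoning
      L = loss D m
      W = Partial.candidates s
      next = step s 1≤n (n≤2*w {w = count W} n≤W+jL (2*jL≤n (<⇒≤ j<m)))
      s′ = proj₁ next
      W′ = Partial.candidates s′
      W≤W′+loss = proj₂ next

    rainbow : ∀ (H : Graph m) → ContainsRainbow H c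
    rainbow H with s , _ ← greedy m ≤-refl = rainbowClique⇒rainbow c H (Partial.φ s) (Partial.clique s)

count-<ᵇ : ∀ k r → r ≤ k → count {k} (λ i → toℕ i <ᵇ r) ≡ r
count-<ᵇ zero    zero    _         = refl
count-<ᵇ (suc k) zero    _         = count-≡0 {k} _ (λ _ → refl)
count-<ᵇ (suc k) (suc r) (s≤s r≤k) = cong suc (count-<ᵇ k r r≤k)

equitable : ∀ k T → Σ (Fin (suc k) → ℕ) λ e → sum e ≡ T × (∀ i → e i ≤ suc (T / suc k))
equitable k T = e , Σe , e≤
  where
  q = T / suc k
  r = T % suc k
  e : Fin (suc k) → ℕ
  e i = q + 𝟙 (toℕ i <ᵇ r)
  Σe : sum e ≡ T
  Σe = begin
    sum e                        ≡⟨ ∑-distrib-+ {suc k} (λ _ → q) (λ i → 𝟙 (toℕ i <ᵇ r)) ⟩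
    ∑[ i < suc k ] q + count {suc k} (λ i → toℕ i <ᵇ r)
                                 ≡⟨ cong₂ _+_ (sum-const (suc k) q) (count-<ᵇ (suc k) r (<⇒≤ (m%n<n T (suc k)))) ⟩
    suc k * q + r                ≡⟨ trans (+-comm _ r) (cong (r +_) (*-comm (suc k) q)) ⟩
    r + q * suc k                ≡⟨ sym (m≡m%n+[m/n]*n T (suc k)) ⟩
    T                            ∎
    where open ≡-Reasoning
  e≤ : ∀ i → e i ≤ suc q
  e≤ i = ≤-trans (+-monoʳ-≤ q (𝟙≤1 _)) (≤-reflexive (+-comm q 1))

D₀ : ℕ → ℕ
D₀ m = suc (6 * m * loss 1 m)

greedy-room : ∀ m b → 1 ≤ b → 2 * m * loss (2 * b + 1) m ≤ D₀ m * b
greedy-room m b 1≤b = begin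
  2 * m * loss (2 * b + 1) m
    ≤⟨ *-monoʳ-≤ (2 * m) (+-monoˡ-≤ ((3 * m + 2 * (m * m)) * (2 * b + 1)) (m≤n+m 1 (2 * b))) ⟩
  2 * m * ((2 * b + 1) + (3 * m + 2 * (m * m)) * (2 * b + 1)) ≡⟨ ring m b ⟩
  2 * m * loss 1 m * (2 * b + 1)              ≤⟨ *-monoʳ-≤ (2 * m * loss 1 m) (+-monoʳ-≤ (2 * b) 1≤b) ⟩
  2 * m * loss 1 m * (2 * b + b)              ≡⟨ ring′ m b ⟩
  6 * m * loss 1 m * b                        ≤⟨ *-monoˡ-≤ b (n≤1+n (6 * m * loss 1 m)) ⟩
  D₀ m * b                                    ∎
  where
  open ≤-Reasoning
  ring : ∀ m b → 2 * m * ((2 * b + 1) + (3 * m + 2 * (m * m)) * (2 * b + 1)) ≡ 2 * m * (1 + (3 * m + 2 * (m * m)) * 1) * (2 * b + 1)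
  ring = solve-∀
  ring′ : ∀ m b → 2 * m * (1 + (3 * m + 2 * (m * m)) * 1) * (2 * b + b) ≡ 6 * m * (1 + (3 * m + 2 * (m * m)) * 1) * b
  ring′ = solve-∀

2*nC2≤n*n : ∀ n → 2 * (n C 2) ≤ n * n
2*nC2≤n*n zero    = z≤n
2*nC2≤n*n (suc n) = ≤-trans (≤-reflexive (2*[1+n]C2≡[1+n]*n n)) (*-monoʳ-≤ (suc n) (n≤1+n n))

D*n≤k : ∀ D N k → 2 * D * N < k → 2 * D * (2 * D) ≤ k → D * (N + 2 * D) ≤ k
D*n≤k D N k 2DN<k 4D²≤k = *-cancelˡ-≤ 2 (begin
  2 * (D * (N + 2 * D))         ≡⟨ ring D N ⟩
  2 * D * N + 2 * D * (2 * D)   ≤⟨ +-mono-≤ (<⇒≤ 2DN<k) 4D²≤k ⟩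
  k + k                         ≡⟨ cong (k +_) (sym (+-identityʳ k)) ⟩
  2 * k                         ∎)
  where
  open ≤-Reasoning
  ring : ∀ D N → 2 * (D * (N + 2 * D)) ≡ 2 * D * N + 2 * D * (2 * D)
  ring = solve-∀

-- Classes of q + 1 edges, where q k ≤ n C 2 ≤ n²/2 and D n ≤ k, give D (q + 1) ≤ n.
class-size-room : ∀ D N k q .{{_ : NonZero k}} → 2 * D * N < k → 2 * D * (2 * D) ≤ k → q * k ≤ (N + 2 * D) C 2 →
  D * suc q ≤ N + 2 * D
class-size-room D N k q 2DN<k 4D²≤k qk≤nC2 = *-cancelˡ-≤ 2 (begin
  2 * (D * suc q)       ≡⟨ ring D q ⟩
  2 * D * q + 2 * D     ≤⟨ +-mono-≤ 2Dq≤n (m≤n+m (2 * D) N) ⟩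
  n + n                 ≡⟨ cong (n +_) (sym (+-identityʳ n)) ⟩
  2 * n                 ∎)
  where
  open ≤-Reasoning
  n = N + 2 * D
  ring : ∀ D q → 2 * (D * suc q) ≡ 2 * D * q + 2 * D
  ring = solve-∀
  ring′ : ∀ D q k → 2 * D * q * k ≡ D * (2 * (q * k))
  ring′ = solve-∀
  2Dq≤n : 2 * D * q ≤ n
  2Dq≤n = *-cancelʳ-≤ (2 * D * q) n k (begin
    2 * D * q * k         ≡⟨ ring′ D q k ⟩
    D * (2 * (q * k))     ≤⟨ *-monoʳ-≤ D (*-monoʳ-≤ 2 qk≤nC2) ⟩
    D * (2 * (n C 2))     ≤⟨ *-monoʳ-≤ D (2*nC2≤n*n n) ⟩
    D * (n * n)           ≡⟨ sym (*-assoc D n n) ⟩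
    D * n * n             ≤⟨ *-monoˡ-≤ n (D*n≤k D N k 2DN<k 4D²≤k) ⟩
    k * n                 ≡⟨ *-comm k n ⟩
    n * k                 ∎)

k/c′≤g : ∀ {m} (H : Graph m) k → 2 * D₀ m * (2 * D₀ m) ≤ k → gAtLeastFrac H k (2 * D₀ m)
k/c′≤g {m} H k@(suc k′) 4D²≤k N 2DN<k threshold =
  rainbowFree (Greedy.rainbow c b small m 1≤n (≤-trans (greedy-room m b (s≤s z≤n)) room) H)
  where
  n = N + 2 * D₀ m
  b = suc ((n C 2) / k)
  room : D₀ m * b ≤ n
  room = class-size-room (D₀ m) N k ((n C 2) / k) 2DN<k 4D²≤k (m/n*n≤m (n C 2) k)
  balanced = equitable k′ (n C 2)
  e = proj₁ balanced
  forced = threshold n (m≤m+n N (2 * D₀ m)) e (trans (sumˡ-map-tabulate e id) (proj₁ (proj₂ balanced)))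
  c = proj₁ forced
  rainbowFree = proj₂ (proj₂ forced)
  small : ∀ γ → colourCount c γ ≤ b
  small γ = ≤-trans (≤-reflexive (proj₁ (proj₂ forced) γ)) (proj₂ (proj₂ balanced) γ)
  1≤n : 1 ≤ n
  1≤n = ≤-trans (s≤s z≤n) (m≤n+m (2 * D₀ m) N)

theorem1p8 : (m : ℕ) →
    Σ ℕ λ c′ → Σ ℕ λ C → Σ ℕ λ K → (1 ≤ c′) × (1 ≤ C) ×
      ((H : Graph m) → DegeneracyAtLeast3 H → (k : ℕ) → K ≤ k →
        (gAtLeastFrac H k c′ × gAtMost H k (C * k)))
theorem1p8 m = 2 * D₀ m , 2 , 2 * D₀ m * (2 * D₀ m) , s≤s z≤n , s≤s z≤n ,
  λ H (_ , ¬2-degenerate) k K≤k →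
    k/c′≤g H k K≤k , g≤2k H ¬2-degenerate k (≤-trans (s≤s z≤n) K≤k)
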